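{- For every $n\ge1$, we have $\psi(K_n,+)=n$, where $(K_n,+)$ is the complete graph on $n$ vertices with all edges positive.
   Context: A signed graph $(G,\sigma)$ is a finite simple graph $G$ with a signature $\sigma:E(G)\to\{ -,+\}$. Switching a set $S\subseteq V(G)$ changes the sign of every edge with exactly one end in $S$; two signed graphs on the same underlying graph are equivalent if one is obtained from the other by switching some set of vertices. For $k\ge1$ let $M_k=\{ -n,\dots,-1,+1,\dots,+n\}$ if $k=2n$, and $M_k=\{ -n,\dots,-1,\pm0,+1,\dots,+n\}$ if $k=2n+1$, where $\pm0$ is a single colour with $-(\pm0)=\pm0$. A $k$-colouring of $(G,\sigma)$ is a map $\phi:V(G)\to M_k$. Let $K_k^*$ be the signed multigraph with vertex set $\{i\ge 0: +i\in M_k\}$ (vertex $0$ standing for colour $\pm0$ when $k$ is odd), in which every two distinct vertices are joined by exactly one positive and one negative edge, and every vertex $i\neq0$ carries exactly one negative loop. Given a $k$-colouring $\phi$, the reduced signed graph $R(G,\sigma,\phi)$ is obtained by (1) switching every vertex with a negative colour $-i$ and recolouring it $+i$; (2) identifying, for each $i$, all vertices of colour $+i$ (resp. $\pm0$) into a single vertex $i$ (resp. $0$), edges inside a class becoming loops; (3) keeping at most one positive and at most one negative edge (or loop) between any two vertices (or at any vertex). The colouring $\phi$ is complete if $R(G,\sigma,\phi)$ is exactly $K_k^*$. The achromatic number $\psi(G,\sigma)$ is the largest $k\ge1$ such that some signed graph equivalent to $(G,\sigma)$ admits a complete $k$-colouring. -}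

module Defs where

open import Data.Nat using (ℕ; zero; suc; _*_; _≤_; _%_)
open import Data.Bool using (Bool; true; false; not)
open import Data.Fin using (Fin; _≟_)
open import Data.Product using (_×_; ∃; ∃₂)
open import Data.Sum using (_⊎_)
open import Relation.Nullary using (¬_)
open import Relation.Nullary.Decidable using (⌊_⌋)
open import Relation.Binary.PropositionalEquality using (_≡_; _≢_)

data Sign : Set where
  plus minus : Sign

_·_ : Sign → Sign → Sign
plus  · s = s
minus · plus  = minus
minus · minus = plus

-- the sign +1 / -1 attached to "is switched / is negatively coloured"
flipIf : Bool → Sign
flipIf true  = minus
flipIf false = plus

record SimpleGraph : Set where
  field
    m      : ℕ
    adj    : Fin m → Fin m → Bool
    sym    : ∀ u v → adj u v ≡ adj v u
    irrefl : ∀ u → adj u u ≡ false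
open SimpleGraph public

-- a signature assigns a sign to each (ordered) pair; only its values on
-- edges matter, and it is required to be symmetric on edges
Signature : SimpleGraph → Set
Signature G = Fin (m G) → Fin (m G) → Sign

IsSignature : (G : SimpleGraph) → Signature G → Set
IsSignature G σ = ∀ u v → adj G u v ≡ true → σ u v ≡ σ v u

switch : (G : SimpleGraph) → (Fin (m G) → Bool) → Signature G → Signature G
switch G S σ u v = (flipIf (S u) · σ u v) · flipIf (S v)

-- Colours of M_k.  A colour is (magnitude i, negative?) ; the colour
-- +i / -i has magnitude i ≥ 1, the colour ±0 has magnitude 0 and is
-- represented canonically with neg = false.

record Colour : Set where
  constructor col
  field
    mag : ℕ
    neg : Bool
open Colour public

-- magnitudes occurring in M_k, i.e. the vertex set of K_k^*:
-- 1 ≤ i with 2i ≤ k, plus 0 when k is odd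
ValidMag : ℕ → ℕ → Set
ValidMag k a = (1 ≤ a × 2 * a ≤ k) ⊎ (a ≡ 0 × k % 2 ≡ 1)

ValidColour : ℕ → Colour → Set
ValidColour k c = ValidMag k (mag c) × (mag c ≡ 0 → neg c ≡ false)

-- sign of an edge uv after step (1) of the reduction (switching every
-- vertex with a negative colour)
redSign : (G : SimpleGraph) → Signature G → (Fin (m G) → Colour) →
          Fin (m G) → Fin (m G) → Sign
redSign G σ φ u v = (flipIf (neg (φ u)) · σ u v) · flipIf (neg (φ v))

-- φ is a complete k-colouring of (G,σ): φ maps into M_k and the reduced
-- signed graph R(G,σ,φ) is exactly K_k^*.
record IsCompleteColouring (G : SimpleGraph) (σ : Signature G) (k : ℕ)
                           (φ : Fin (m G) → Colour) : Set where
  field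
    valid     : ∀ v → ValidColour k (φ v)
    onto      : ∀ a → ValidMag k a → ∃ λ v → mag (φ v) ≡ a
    edges     : ∀ a b → ValidMag k a → ValidMag k b → a ≢ b → ∀ s →
                ∃₂ λ u v → adj G u v ≡ true × mag (φ u) ≡ a ×
                           mag (φ v) ≡ b × redSign G σ φ u v ≡ s
    -- a negative loop at every vertex i ≠ 0
    negLoops  : ∀ a → ValidMag k a → a ≢ 0 →
                ∃₂ λ u v → adj G u v ≡ true × mag (φ u) ≡ a ×
                           mag (φ v) ≡ a × redSign G σ φ u v ≡ minus
    -- no positive loops
    noPosLoop : ∀ u v → adj G u v ≡ true → mag (φ u) ≡ mag (φ v) →
                redSign G σ φ u v ≡ minus
    -- no loops at all at vertex 0
    noLoop0   : ∀ u v → adj G u v ≡ true → mag (φ u) ≡ mag (φ v) →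
                mag (φ u) ≢ 0

HasCompleteColouring : (G : SimpleGraph) → Signature G → ℕ → Set
HasCompleteColouring G σ k =
  ∃₂ λ (S : Fin (m G) → Bool) (φ : Fin (m G) → Colour) →
    IsCompleteColouring G (switch G S σ) k φ

AchromaticNumberIs : (G : SimpleGraph) → Signature G → ℕ → Set
AchromaticNumberIs G σ n =
  1 ≤ n × HasCompleteColouring G σ n ×
  (∀ k → 1 ≤ k → HasCompleteColouring G σ k → k ≤ n)

neq : ∀ {n} → Fin n → Fin n → Bool
neq u v = not ⌊ u ≟ v ⌋

open import Relation.Nullary using (yes; no)
open import Relation.Binary.PropositionalEquality using (refl)
  renaming (sym to ≡sym)
open import Data.Empty using (⊥-elim)

private
  neq-sym : ∀ {n} (u v : Fin n) → neq u v ≡ neq v u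
  neq-sym u v with u ≟ v | v ≟ u
  ... | yes _ | yes _ = refl
  ... | no _  | no _  = refl
  ... | yes p | no q  = ⊥-elim (q (≡sym p))
  ... | no p  | yes q = ⊥-elim (p (≡sym q))

  neq-irrefl : ∀ {n} (u : Fin n) → neq u u ≡ false
  neq-irrefl u with u ≟ u
  ... | yes _ = refl
  ... | no p  = ⊥-elim (p refl)

K : ℕ → SimpleGraph
K n = record { m = n ; adj = neq ; sym = neq-sym ; irrefl = neq-irrefl }

allPlus : (G : SimpleGraph) → Signature G
allPlus G _ _ = plus

module Submission where

open import Defs hiding (sym)
open import Data.Nat using (ℕ; zero; suc; _≤_; z≤n; s≤s)
open import Data.Nat.Properties using (*-suc; ≤-irrelevant; ≡-irrelevant)
open import Data.Fin using (Fin; zero; suc; _≟_)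
open import Data.Fin.Properties using (injective⇒≤)
open import Data.Bool using (Bool; true; false)
open import Data.Product using (_×_; _,_; proj₁; proj₂; ∃; ∃₂)
open import Data.Sum using (inj₁; inj₂)
open import Data.Empty using (⊥-elim)
open import Function using (_∘_)
open import Relation.Nullary using (yes; no)
open import Relation.Binary.PropositionalEquality

-- M_(k+2) consists of ±1 together with the colours of M_k moved one magnitude up,
-- which gives an explicit enumeration Fin k ≅ M_k. A complete k-colouring needs
-- two distinct (adjacent) vertices of each magnitude i ≥ 1 and one of magnitude 0
-- when k is odd, so at least |M_k| = k vertices. Conversely, colouring the
-- vertices of K_n by the enumeration of M_n is complete: any two colours meet on
-- a positive edge, and the colours ±i meet on a negative one.

adj⇒≢ : (G : SimpleGraph) {u v : Fin (m G)} → adj G u v ≡ true → u ≢ v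
adj⇒≢ G {u} uv refl with trans (sym uv) (irrefl G u)
... | ()

validMag-irrelevant : ∀ {k a} (p q : ValidMag k a) → p ≡ q
validMag-irrelevant (inj₁ (p , p′)) (inj₁ (q , q′)) =
  cong₂ (λ x y → inj₁ (x , y)) (≤-irrelevant p q) (≤-irrelevant p′ q′)
validMag-irrelevant (inj₂ (refl , p)) (inj₂ (refl , q)) =
  cong (λ x → inj₂ (refl , x)) (≡-irrelevant p q)
validMag-irrelevant (inj₁ (() , _)) (inj₂ (refl , _))
validMag-irrelevant (inj₂ (refl , _)) (inj₁ (() , _))

validColour-mag≡0 : ∀ {k} c → ValidColour k c → mag c ≡ 0 → c ≡ col 0 false
validColour-mag≡0 (col zero _) (_ , neg≡false) refl = cong (col 0) (neg≡false refl)

raise : Colour → Colour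
raise (col zero    b) = col zero b
raise (col (suc a) b) = col (suc (suc a)) b

raise-injective : ∀ {c c′} → raise c ≡ raise c′ → c ≡ c′
raise-injective {col zero    _} {col zero     _} refl = refl
raise-injective {col (suc _) _} {col (suc _)  _} refl = refl

raise-mag≢1 : ∀ c → mag (raise c) ≢ 1
raise-mag≢1 (col zero    _) ()
raise-mag≢1 (col (suc _) _) ()

validMag-raise : ∀ {k a} → ValidMag k (suc a) → ValidMag (suc (suc k)) (suc (suc a))
validMag-raise {k} {a} (inj₁ (_ , 2a+2≤k)) =
  inj₁ (s≤s z≤n , subst (_≤ suc (suc k)) (sym (*-suc 2 (suc a))) (s≤s (s≤s 2a+2≤k)))

validMag-lower : ∀ {k a} → ValidMag (suc (suc k)) (suc (suc a)) → ValidMag k (suc a)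
validMag-lower {k} {a} (inj₁ (_ , 2a+4≤k+2))
  with subst (_≤ suc (suc k)) (*-suc 2 (suc a)) 2a+4≤k+2
... | s≤s (s≤s 2a+2≤k) = inj₁ (s≤s z≤n , 2a+2≤k)

raise-valid : ∀ {k} c → ValidColour k c → ValidColour (suc (suc k)) (raise c)
raise-valid (col zero    b) (inj₂ (refl , odd) , neg≡false) = inj₂ (refl , odd) , neg≡false
raise-valid (col zero    b) (inj₁ (() , _) , _)
raise-valid (col (suc a) b) (valid , _) = validMag-raise valid , λ ()

enumColour : (k : ℕ) → Fin k → Colour
enumColour (suc zero)    zero          = col 0 false
enumColour (suc (suc k)) zero          = col 1 false
enumColour (suc (suc k)) (suc zero)    = col 1 true
enumColour (suc (suc k)) (suc (suc j)) = raise (enumColour k j)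

enumColour-valid : ∀ k j → ValidColour k (enumColour k j)
enumColour-valid (suc zero)    zero          = inj₂ (refl , refl) , λ _ → refl
enumColour-valid (suc (suc k)) zero          = inj₁ (s≤s z≤n , s≤s (s≤s z≤n)) , λ ()
enumColour-valid (suc (suc k)) (suc zero)    = inj₁ (s≤s z≤n , s≤s (s≤s z≤n)) , λ ()
enumColour-valid (suc (suc k)) (suc (suc j)) = raise-valid (enumColour k j) (enumColour-valid k j)

enumColour-injective : ∀ k {i j} → enumColour k i ≡ enumColour k j → i ≡ j
enumColour-injective (suc zero)    {zero}        {zero}        _ = refl
enumColour-injective (suc (suc k)) {zero}        {zero}        _ = refl
enumColour-injective (suc (suc k)) {suc zero}    {suc zero}    _ = refl
enumColour-injective (suc (suc k)) {zero}        {suc zero}    ()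
enumColour-injective (suc (suc k)) {suc zero}    {zero}        ()
enumColour-injective (suc (suc k)) {zero}        {suc (suc j)} e =
  ⊥-elim (raise-mag≢1 (enumColour k j) (cong mag (sym e)))
enumColour-injective (suc (suc k)) {suc zero}    {suc (suc j)} e =
  ⊥-elim (raise-mag≢1 (enumColour k j) (cong mag (sym e)))
enumColour-injective (suc (suc k)) {suc (suc i)} {zero}        e =
  ⊥-elim (raise-mag≢1 (enumColour k i) (cong mag e))
enumColour-injective (suc (suc k)) {suc (suc i)} {suc zero}    e =
  ⊥-elim (raise-mag≢1 (enumColour k i) (cong mag e))
enumColour-injective (suc (suc k)) {suc (suc i)} {suc (suc j)} e =
  cong (λ x → suc (suc x)) (enumColour-injective k (raise-injective e))

enumColour-surjective : ∀ k c → ValidColour k c → ∃ λ j → enumColour k j ≡ c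
enumColour-surjective zero (col zero    _) (inj₂ (_ , ()) , _)
enumColour-surjective zero (col zero    _) (inj₁ (() , _) , _)
enumColour-surjective zero (col (suc _) _) (inj₁ (_ , ()) , _)
enumColour-surjective (suc zero) (col zero false) _ = zero , refl
enumColour-surjective (suc zero) (col zero true) (_ , neg≡false) with neg≡false refl
... | ()
enumColour-surjective (suc zero) (col (suc a) _) (inj₁ (_ , 2a+2≤1) , _)
  with subst (_≤ 1) (*-suc 2 a) 2a+2≤1
... | s≤s ()
enumColour-surjective (suc (suc k)) (col zero b) (inj₁ (() , _) , _)
enumColour-surjective (suc (suc k)) (col zero b) (inj₂ (refl , odd) , neg≡false)
  with neg≡false refl | enumColour-surjective k (col 0 false) (inj₂ (refl , odd) , λ _ → refl)
... | refl | j , e = suc (suc j) , cong raise e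
enumColour-surjective (suc (suc k)) (col (suc zero) false) _ = zero , refl
enumColour-surjective (suc (suc k)) (col (suc zero) true)  _ = suc zero , refl
enumColour-surjective (suc (suc k)) (col (suc (suc a)) b) (valid , _)
  with enumColour-surjective k (col (suc a) b) (validMag-lower valid , λ ())
... | j , e = suc (suc j) , cong raise e

module _ {G : SimpleGraph} {σ : Signature G} {k : ℕ} {φ : Fin (m G) → Colour}
         (C : IsCompleteColouring G σ k φ) where
  open IsCompleteColouring C

  -- the ends of the negative loop at i realise the colours +i and -i
  representative : ∀ a b → ValidColour k (col a b) → Fin (m G)
  representative zero    _     (valid , _) = proj₁ (onto 0 valid)
  representative (suc a) false (valid , _) = proj₁ (negLoops (suc a) valid λ ())
  representative (suc a) true  (valid , _) = proj₁ (proj₂ (negLoops (suc a) valid λ ()))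

  representative-mag : ∀ a b p → mag (φ (representative a b p)) ≡ a
  representative-mag zero    _     (valid , _) = proj₂ (onto 0 valid)
  representative-mag (suc a) false (valid , _) =
    proj₁ (proj₂ (proj₂ (proj₂ (negLoops (suc a) valid λ ()))))
  representative-mag (suc a) true  (valid , _) =
    proj₁ (proj₂ (proj₂ (proj₂ (proj₂ (negLoops (suc a) valid λ ())))))

  representative-injective : ∀ a b a′ b′ p p′ →
    representative a b p ≡ representative a′ b′ p′ → col a b ≡ col a′ b′
  representative-injective a b a′ b′ p p′ e
    with trans (sym (representative-mag a b p))
               (trans (cong (mag ∘ φ) e) (representative-mag a′ b′ p′))
  representative-injective zero b .zero b′ p p′ e | refl =
    trans (validColour-mag≡0 _ p refl) (sym (validColour-mag≡0 _ p′ refl))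
  representative-injective (suc a) b .(suc a) b′ (valid , _) (valid′ , _) e | refl
    with validMag-irrelevant valid valid′
  ... | refl = sameLoop b b′ _ _ e
    where
      ends-distinct :
        representative (suc a) false (valid , λ ()) ≢ representative (suc a) true (valid , λ ())
      ends-distinct = adj⇒≢ G (proj₁ (proj₂ (proj₂ (negLoops (suc a) valid λ ()))))
      sameLoop : ∀ b b′ z z′ →
                 representative (suc a) b (valid , z) ≡ representative (suc a) b′ (valid , z′) →
                 col (suc a) b ≡ col (suc a) b′
      sameLoop false false _ _ _ = refl
      sameLoop true  true  _ _ _ = refl
      sameLoop false true  _ _ e = ⊥-elim (ends-distinct e)
      sameLoop true  false _ _ e = ⊥-elim (ends-distinct (sym e))

  completeColouring⇒≤ : k ≤ m G
  completeColouring⇒≤ = injective⇒≤ {f = pick} pick-injective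
    where
      pick : Fin k → Fin (m G)
      pick j = representative (mag (enumColour k j)) (neg (enumColour k j)) (enumColour-valid k j)
      pick-injective : ∀ {i j} → pick i ≡ pick j → i ≡ j
      pick-injective e = enumColour-injective k (representative-injective _ _ _ _ _ _ e)

K-adj : ∀ {n} {u v : Fin n} → u ≢ v → adj (K n) u v ≡ true
K-adj {u = u} {v} u≢v with u ≟ v
... | yes u≡v = ⊥-elim (u≢v u≡v)
... | no  _   = refl

positiveEdgeSign : Colour → Colour → Sign
positiveEdgeSign c c′ = (flipIf (neg c) · plus) · flipIf (neg c′)

isMinus : Sign → Bool
isMinus plus  = false
isMinus minus = true

positiveEdgeSign-fromˡ : ∀ s a b → positiveEdgeSign (col a (isMinus s)) (col b false) ≡ s
positiveEdgeSign-fromˡ plus  _ _ = refl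
positiveEdgeSign-fromˡ minus _ _ = refl

positiveEdgeSign-fromʳ : ∀ s a b → positiveEdgeSign (col a false) (col b (isMinus s)) ≡ s
positiveEdgeSign-fromʳ plus  _ _ = refl
positiveEdgeSign-fromʳ minus _ _ = refl

positiveEdgeSign-sameMag : ∀ c c′ → mag c ≡ mag c′ → c ≢ c′ → positiveEdgeSign c c′ ≡ minus
positiveEdgeSign-sameMag (col a false) (col .a false) refl c≢c′ = ⊥-elim (c≢c′ refl)
positiveEdgeSign-sameMag (col a false) (col .a true)  refl _    = refl
positiveEdgeSign-sameMag (col a true)  (col .a false) refl _    = refl
positiveEdgeSign-sameMag (col a true)  (col .a true)  refl c≢c′ = ⊥-elim (c≢c′ refl)

module _ (n : ℕ) where
  private
    φ : Fin n → Colour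
    φ = enumColour n

  edgeBetween : ∀ {c c′ s} → ValidColour n c → ValidColour n c′ → c ≢ c′ →
                positiveEdgeSign c c′ ≡ s →
                ∃₂ λ u v → adj (K n) u v ≡ true × mag (φ u) ≡ mag c ×
                           mag (φ v) ≡ mag c′ × redSign (K n) (allPlus (K n)) φ u v ≡ s
  edgeBetween {c} {c′} valid valid′ c≢c′ sign
    with enumColour-surjective n c valid | enumColour-surjective n c′ valid′
  ... | u , refl | v , refl =
    u , v , K-adj (λ u≡v → c≢c′ (cong φ u≡v)) , refl , refl , sign

  enumColour-complete : IsCompleteColouring (K n) (allPlus (K n)) n φ
  enumColour-complete = record
    { valid     = enumColour-valid n
    ; onto      = onto
    ; edges     = edges
    ; negLoops  = negLoops
    ; noPosLoop = noPosLoop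
    ; noLoop0   = noLoop0
    }
    where
      onto : ∀ a → ValidMag n a → ∃ λ v → mag (φ v) ≡ a
      onto a valid with enumColour-surjective n (col a false) (valid , λ _ → refl)
      ... | v , e = v , cong mag e

      edges : ∀ a b → ValidMag n a → ValidMag n b → a ≢ b → ∀ s →
              ∃₂ λ u v → adj (K n) u v ≡ true × mag (φ u) ≡ a × mag (φ v) ≡ b ×
                         redSign (K n) (allPlus (K n)) φ u v ≡ s
      edges zero zero _ _ a≢b _ = ⊥-elim (a≢b refl)
      edges zero (suc b) valid valid′ _ s =
        edgeBetween (valid , λ _ → refl) (valid′ , λ ()) (λ ()) (positiveEdgeSign-fromʳ s 0 (suc b))
      edges (suc a) b valid valid′ a≢b s =
        edgeBetween (valid , λ ()) (valid′ , λ _ → refl) (a≢b ∘ cong mag)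
                    (positiveEdgeSign-fromˡ s (suc a) b)

      negLoops : ∀ a → ValidMag n a → a ≢ 0 →
                 ∃₂ λ u v → adj (K n) u v ≡ true × mag (φ u) ≡ a × mag (φ v) ≡ a ×
                            redSign (K n) (allPlus (K n)) φ u v ≡ minus
      negLoops zero    _     a≢0 = ⊥-elim (a≢0 refl)
      negLoops (suc a) valid _   =
        edgeBetween {col (suc a) false} {col (suc a) true} (valid , λ ()) (valid , λ ()) (λ ()) refl

      colours-distinct : ∀ {u v} → adj (K n) u v ≡ true → φ u ≢ φ v
      colours-distinct uv = adj⇒≢ (K n) uv ∘ enumColour-injective n

      noPosLoop : ∀ u v → adj (K n) u v ≡ true → mag (φ u) ≡ mag (φ v) →
                  redSign (K n) (allPlus (K n)) φ u v ≡ minus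
      noPosLoop u v uv sameMag = positiveEdgeSign-sameMag (φ u) (φ v) sameMag (colours-distinct uv)

      noLoop0 : ∀ u v → adj (K n) u v ≡ true → mag (φ u) ≡ mag (φ v) → mag (φ u) ≢ 0
      noLoop0 u v uv sameMag zero-u = colours-distinct uv (trans
        (validColour-mag≡0 (φ u) (enumColour-valid n u) zero-u)
        (sym (validColour-mag≡0 (φ v) (enumColour-valid n v) (trans (sym sameMag) zero-u))))

theorem2p10 : ∀ (n : ℕ) → 1 ≤ n → AchromaticNumberIs (K n) (allPlus (K n)) n
theorem2p10 n 1≤n =
  1≤n ,
  ((λ _ → false) , enumColour n , enumColour-complete n) ,
  λ k _ (_ , _ , complete) → completeColouring⇒≤ complete
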